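{- Let $m > 1$ be an integer, written as $m = 2^{\nu_2(m)} \cdot m_1$ with $m_1$ odd. If $m_1 \equiv 1 \pmod 4$, then $S_2(m)$ is empty.
   Context: For a positive integer $x$, $\nu_2(x)$ denotes the largest integer $e$ such that $2^e$ divides $x$. For a positive integer $m$, consider the positive rational solutions $(x,y)$ of $x^y = y^{mx}$. $S_2(m)$ denotes the set of such solutions with $x \neq 1$, $y \neq 1$, for which $y = x^{a/b}$ with $a, b$ coprime positive integers satisfying $|a - b| = 2$. -}

module Defs where

open import Data.Nat using (ℕ; zero; suc; _*_)
open import Data.Integer using (+_; ∣_∣)
open import Data.Rational using (ℚ; 1ℚ; ↥_; ↧ₙ_; _/_)
import Data.Rational as Q
open import Relation.Binary.PropositionalEquality using (_≡_)

pow : ℚ → ℕ → ℚ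
pow q zero    = 1ℚ
pow q (suc n) = q Q.* pow q n

ℕ→ℚ : ℕ → ℚ
ℕ→ℚ m = + m / 1

-- For positive rationals α, β and positive rational exponents e, f,
-- the real equation  α ^ e = β ^ f  holds iff (raising both sides to the
-- positive integer power den(e)*den(f))  α ^ (num e * den f) = β ^ (num f * den e).
RPowEq : ℚ → ℚ → ℚ → ℚ → Set
RPowEq α e β f = pow α (∣ ↥ e ∣ * ↧ₙ f) ≡ pow β (∣ ↥ f ∣ * ↧ₙ e)

-- (x , y) is an element of S₂(m): x, y positive rationals, x ≠ 1, y ≠ 1,
-- x ^ y = y ^ (m x), and y = x ^ (a / b) with a, b coprime positive
-- integers with |a - b| = 2  (y = x^(a/b) is expressed as y ^ b = x ^ a).

{-# OPTIONS --safe #-}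
module Submission where

-- From x^y = y^(m x) and y = x^(a/b), comparing exponents of y ≠ 1 gives b y = a m x, and then
-- y^b = x^a becomes b^b x^(a-b) = (a m)^b with a - b = ±2.  As b is odd, b (a m) is the square
-- of a rational, hence of a natural number.  But a and b are odd with |a - b| = 2, so
-- a b ≡ 3 (mod 4), and b (a m) = 2^e (a b m₁) with a b m₁ ≡ 3 (mod 4) is never a square.

open import Defs
open import Data.Nat using (ℕ; _<_; _^_; _%_; _+_; _*_)
open import Data.Nat.Coprimality using (Coprime)
open import Data.Rational using (ℚ; Positive; 1ℚ)
import Data.Rational as Q
open import Data.Product using (Σ; _×_)
open import Data.Sum using (_⊎_)
open import Relation.Binary.PropositionalEquality using (_≡_; _≢_)
open import Relation.Nullary using (¬_)

open import Algebra.Bundles using (CommutativeRing)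
import Algebra.Properties.CommutativeSemiring.Exp as Exp
open import Data.Empty using (⊥; ⊥-elim)
open import Data.Integer as ℤ using (+_; +[1+_]; ∣_∣)
import Data.Integer.Properties as ℤ
open import Data.Nat using (zero; suc; _∸_; _/_; _≤_; s≤s; z≤n; NonZero; ≢-nonZero; ≢-nonZero⁻¹; >-nonZero)
import Data.Nat.Coprimality as Coprimality
open import Data.Nat.DivMod using (m≡m%n+[m/n]*n; m/n*n≡m; %-distribˡ-*; [m+kn]%n≡m%n; m%n<n)
open import Data.Nat.Divisibility using (_∣_; divides; ∣-refl; ∣m∣n⇒∣m+n; ∣m+n∣m⇒∣n; m%n≡0⇒n∣m; m∣m*n; ∣m⇒∣m*n)
open import Data.Nat.GCD using (gcd; gcd[m,n]∣m; gcd[m,n]∣n; gcd[m,n]≢0)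
open import Data.Nat.Primality using (Prime; euclidsLemma; prime[2])
import Data.Nat.Properties as ℕ
open import Data.Nat.Tactic.RingSolver using (solve-∀)
open import Data.Product using (_,_; ∃-syntax; map₂)
open import Data.Rational using (mkℚ; ↥_; ↧ₙ_)
import Data.Rational.Properties as QP
import Data.Rational.Unnormalised as ℚᵘ
open import Data.Sum using (inj₁; inj₂; [_,_]′)
open import Function using (id)
open import Relation.Binary.Definitions using (tri<; tri≈; tri>)
open import Relation.Binary.PropositionalEquality using (refl; sym; trans; cong; cong₂; subst; module ≡-Reasoning)
open import Relation.Nullary using (contradiction)

n%2≡1⇒n≡1+[n/2]*2 : ∀ n → n % 2 ≡ 1 → n ≡ 1 + n / 2 * 2
n%2≡1⇒n≡1+[n/2]*2 n n%2≡1 = trans (m≡m%n+[m/n]*n n 2) (cong (_+ n / 2 * 2) n%2≡1)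

^-injectiveˡ : ∀ k .{{_ : NonZero k}} {m n} → m ^ k ≡ n ^ k → m ≡ n
^-injectiveˡ k {m} {n} eq with ℕ.<-cmp m n
... | tri< m<n _ _ = ⊥-elim (ℕ.<-irrefl eq (ℕ.^-monoˡ-< k m<n))
... | tri≈ _ m≡n _ = m≡n
... | tri> _ _ m>n = ⊥-elim (ℕ.<-irrefl (sym eq) (ℕ.^-monoˡ-< k m>n))

square%4≤1 : ∀ c → c * c % 4 ≤ 1
square%4≤1 c = subst (_≤ 1) (sym (%-distribˡ-* c c 4)) (residue (m%n<n c 4))
  where
  residue : ∀ {r} → r < 4 → r * r % 4 ≤ 1
  residue {0} _ = z≤n
  residue {1} _ = ℕ.≤-refl
  residue {2} _ = z≤n
  residue {3} _ = ℕ.≤-refl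
  residue {suc (suc (suc (suc _)))} (s≤s (s≤s (s≤s (s≤s ()))))

%4≥2⇒≢square : ∀ {m} c → 2 ≤ m % 4 → m ≢ c * c
%4≥2⇒≢square c 2≤m%4 refl = ℕ.<⇒≱ (s≤s (square%4≤1 c)) 2≤m%4

prime∣square⇒∣ : ∀ {p c} → Prime p → p ∣ c * c → p ∣ c
prime∣square⇒∣ {c = c} pp p∣c² = [ id , id ]′ (euclidsLemma c c pp p∣c²)

2^e*n≢square : ∀ e n c → n % 4 ≡ 3 → 2 ^ e * n ≢ c * c
2^e*n≢square zero n c n%4≡3 rewrite ℕ.+-identityʳ n =
  %4≥2⇒≢square c (subst (2 ≤_) (sym n%4≡3) (ℕ.n≤1+n 2))
2^e*n≢square (suc zero) n c n%4≡3 =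
  %4≥2⇒≢square c (ℕ.≤-reflexive (sym (trans (%-distribˡ-* 2 n 4) (cong (λ k → 2 * k % 4) n%4≡3))))
2^e*n≢square (suc (suc e)) n c n%4≡3 4[2ᵉn]≡c² = halve (prime∣square⇒∣ prime[2] 2∣c²)
  where
  open ≡-Reasoning
  2∣c² : 2 ∣ c * c
  2∣c² = subst (2 ∣_) 4[2ᵉn]≡c² (∣m⇒∣m*n n (m∣m*n (2 ^ suc e)))
  quadruple : ∀ P k → P * k * 4 ≡ 2 * (2 * P) * k
  quadruple = solve-∀
  square-double : ∀ k → k * 2 * (k * 2) ≡ k * k * 4
  square-double = solve-∀
  halve : 2 ∣ c → ⊥
  halve (divides d c≡d*2) = 2^e*n≢square e n d n%4≡3 (ℕ.*-cancelʳ-≡ _ _ 4 (begin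
    2 ^ e * n * 4        ≡⟨ quadruple (2 ^ e) n ⟩
    2 ^ suc (suc e) * n  ≡⟨ 4[2ᵉn]≡c² ⟩
    c * c                ≡⟨ cong (λ k → k * k) c≡d*2 ⟩
    d * 2 * (d * 2)      ≡⟨ square-double d ⟩
    d * d * 4            ∎))

∣-twin : ∀ {d m n} → d ∣ 2 → d ∣ n → m ≡ n + 2 ⊎ n ≡ m + 2 → d ∣ m
∣-twin d∣2 d∣n (inj₁ refl) = ∣m∣n⇒∣m+n d∣n d∣2
∣-twin {d} {m} d∣2 d∣m+2 (inj₂ refl) = ∣m+n∣m⇒∣n (subst (d ∣_) (ℕ.+-comm m 2) d∣m+2) d∣2

twin-coprime⇒odd : ∀ {m n} → Coprime m n → m ≡ n + 2 ⊎ n ≡ m + 2 → n % 2 ≡ 1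
twin-coprime⇒odd {m} {n} m⊥n twin with n % 2 in n%2≡r | m%n<n n 2
... | 0 | _ = contradiction (m⊥n (∣-twin ∣-refl 2∣n twin , 2∣n)) λ ()
  where
  2∣n : 2 ∣ n
  2∣n = m%n≡0⇒n∣m n 2 n%2≡r
... | 1 | _ = refl
... | suc (suc _) | s≤s (s≤s ())

[n+2]*n%4≡3 : ∀ n → n % 2 ≡ 1 → (n + 2) * n % 4 ≡ 3
[n+2]*n%4≡3 n n%2≡1 = begin
  (n + 2) * n % 4                    ≡⟨ cong (λ k → (k + 2) * k % 4) (n%2≡1⇒n≡1+[n/2]*2 n n%2≡1) ⟩
  (1 + j * 2 + 2) * (1 + j * 2) % 4  ≡⟨ cong (_% 4) (expand j) ⟩
  (3 + (j * j + 2 * j) * 4) % 4      ≡⟨ [m+kn]%n≡m%n 3 (j * j + 2 * j) 4 ⟩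
  3                                  ∎
  where
  open ≡-Reasoning
  j : ℕ
  j = n / 2
  expand : ∀ k → (1 + k * 2 + 2) * (1 + k * 2) ≡ 3 + (k * k + 2 * k) * 4
  expand = solve-∀

twin-coprime⇒*%4≡3 : ∀ {m n} → Coprime m n → m ≡ n + 2 ⊎ n ≡ m + 2 → m * n % 4 ≡ 3
twin-coprime⇒*%4≡3 {n = n} m⊥n twin@(inj₁ refl) = [n+2]*n%4≡3 n (twin-coprime⇒odd m⊥n twin)
twin-coprime⇒*%4≡3 {m} m⊥n (inj₂ refl) = trans (cong (_% 4) (ℕ.*-comm m (m + 2)))
  ([n+2]*n%4≡3 m (twin-coprime⇒odd (Coprimality.sym m⊥n) (inj₁ refl)))

%4≡3⇒*%4≡3 : ∀ m n → m % 4 ≡ 3 → n % 4 ≡ 1 → m * n % 4 ≡ 3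
%4≡3⇒*%4≡3 m n m%4≡3 n%4≡1 =
  trans (%-distribˡ-* m n 4) (cong₂ (λ u v → u * v % 4) m%4≡3 n%4≡1)

twin-*-nonsquare : ∀ {a b m} e {m₁} → Coprime a b → a ≡ b + 2 ⊎ b ≡ a + 2 →
                   m ≡ 2 ^ e * m₁ → m₁ % 4 ≡ 1 → ¬ (∃[ c ] b * (a * m) ≡ c * c)
twin-*-nonsquare {a} {b} {m} e {m₁} a⊥b twin m≡2ᵉm₁ m₁%4≡1 (c , b[am]≡c²) =
  2^e*n≢square e (a * b * m₁) c (%4≡3⇒*%4≡3 (a * b) m₁ (twin-coprime⇒*%4≡3 a⊥b twin) m₁%4≡1) (begin
    2 ^ e * (a * b * m₁)    ≡⟨ regroup (2 ^ e) a b m₁ ⟩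
    b * (a * (2 ^ e * m₁))  ≡⟨ cong (λ k → b * (a * k)) m≡2ᵉm₁ ⟨
    b * (a * m)             ≡⟨ b[am]≡c² ⟩
    c * c                   ∎)
  where
  open ≡-Reasoning
  regroup : ∀ P k l n → P * (k * l * n) ≡ l * (k * (P * n))
  regroup = solve-∀

*-square≡square⇒square : ∀ {n z w} .{{_ : NonZero z}} → n * (z * z) ≡ w * w → ∃[ c ] n ≡ c * c
*-square≡square⇒square {n} {z} {w} eq = w′ , (begin
  n             ≡⟨ ℕ.*-identityʳ n ⟨
  n * (1 * 1)   ≡⟨ cong (λ k → n * (k * k)) z′≡1 ⟨
  n * (z′ * z′) ≡⟨ reduced ⟩
  w′ * w′       ∎)
  where
  open ≡-Reasoning
  g : ℕ
  g = gcd z w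
  instance
    g≢0 : NonZero g
    g≢0 = ≢-nonZero (gcd[m,n]≢0 z w (inj₁ (≢-nonZero⁻¹ z)))
  z′ w′ : ℕ
  z′ = z / g
  w′ = w / g
  square-* : ∀ k l → k * l * (k * l) ≡ k * k * (l * l)
  square-* = solve-∀
  reduced : n * (z′ * z′) ≡ w′ * w′
  reduced = ℕ.*-cancelʳ-≡ _ _ (g * g) {{ℕ.m*n≢0 g g}} (begin
    n * (z′ * z′) * (g * g)     ≡⟨ ℕ.*-assoc n (z′ * z′) (g * g) ⟩
    n * (z′ * z′ * (g * g))     ≡⟨ cong (n *_) (square-* z′ g) ⟨
    n * (z′ * g * (z′ * g))     ≡⟨ cong (λ k → n * (k * k)) (m/n*n≡m (gcd[m,n]∣m z w)) ⟩
    n * (z * z)                 ≡⟨ eq ⟩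
    w * w                       ≡⟨ cong (λ k → k * k) (m/n*n≡m (gcd[m,n]∣n z w)) ⟨
    w′ * g * (w′ * g)           ≡⟨ square-* w′ g ⟩
    w′ * w′ * (g * g)           ∎)
  z′⊥w′ : Coprime z′ w′
  z′⊥w′ = Coprimality.coprime-/gcd z w
  z′∣w′ : z′ ∣ w′
  z′∣w′ = Coprimality.coprime-divisor z′⊥w′
    (divides (n * z′) (trans (sym reduced) (sym (ℕ.*-assoc n z′ z′))))
  z′≡1 : z′ ≡ 1
  z′≡1 = z′⊥w′ (∣-refl , z′∣w′)

^-odd : ∀ m j → m ^ (1 + j * 2) ≡ m * (m ^ j * m ^ j)
^-odd m j = cong (m *_) (trans (sym (ℕ.^-*-assoc m j 2)) (cong (m ^ j *_) (ℕ.*-identityʳ (m ^ j))))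

odd-power-balance⇒*-square : ∀ {K L U V} c .{{_ : NonZero U}} .{{_ : NonZero K}} → c % 2 ≡ 1 →
                             K ^ c * (U * U) ≡ L ^ c * (V * V) → ∃[ s ] K * L ≡ s * s
odd-power-balance⇒*-square {K} {L} {U} {V} c c%2≡1 eq =
  *-square≡square⇒square {z = K ^ j * U} {w = L * L ^ j * V} {{ℕ.m*n≢0 (K ^ j) U {{ℕ.m^n≢0 K j}}}} (begin
    K * L * (K ^ j * U * (K ^ j * U))    ≡⟨ regroupˡ K L (K ^ j) U ⟩
    L * (K * (K ^ j * K ^ j) * (U * U))  ≡⟨ cong (λ k → L * (k * (U * U))) (odd-power K) ⟨
    L * (K ^ c * (U * U))                ≡⟨ cong (L *_) eq ⟩
    L * (L ^ c * (V * V))                ≡⟨ cong (λ k → L * (k * (V * V))) (odd-power L) ⟩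
    L * (L * (L ^ j * L ^ j) * (V * V))  ≡⟨ regroupʳ L (L ^ j) V ⟩
    L * L ^ j * V * (L * L ^ j * V)      ∎)
  where
  open ≡-Reasoning
  j : ℕ
  j = c / 2
  odd-power : ∀ M → M ^ c ≡ M * (M ^ j * M ^ j)
  odd-power M = trans (cong (M ^_) (n%2≡1⇒n≡1+[n/2]*2 c c%2≡1)) (^-odd M j)
  regroupˡ : ∀ k l p u → k * l * (p * u * (p * u)) ≡ l * (k * (p * p) * (u * u))
  regroupˡ = solve-∀
  regroupʳ : ∀ l q v → l * (l * (q * q) * (v * v)) ≡ l * q * v * (l * q * v)
  regroupʳ = solve-∀

module ℚ-Exp = Exp (CommutativeRing.commutativeSemiring QP.+-*-commutativeRing)
open ℚ-Exp using (^-homo-*; ^-assocʳ; ^-distrib-*) renaming (_^_ to _^ℚ_)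

pow≡^ℚ : ∀ q n → pow q n ≡ q ^ℚ n
pow≡^ℚ q zero    = refl
pow≡^ℚ q (suc n) = cong (q Q.*_) (pow≡^ℚ q n)

pow≡pow⇒^ℚ≡^ℚ : ∀ p i q j → pow p i ≡ pow q j → p ^ℚ i ≡ q ^ℚ j
pow≡pow⇒^ℚ≡^ℚ p i q j eq = trans (sym (pow≡^ℚ p i)) (trans eq (pow≡^ℚ q j))

*-cancelˡ-≡-pos : ∀ r .{{_ : Positive r}} {p q} → r Q.* p ≡ r Q.* q → p ≡ q
*-cancelˡ-≡-pos r eq =
  QP.≤-antisym (QP.*-cancelˡ-≤-pos r (QP.≤-reflexive eq)) (QP.*-cancelˡ-≤-pos r (QP.≤-reflexive (sym eq)))

*-cancelʳ-≡-pos : ∀ r .{{_ : Positive r}} {p q} → p Q.* r ≡ q Q.* r → p ≡ q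
*-cancelʳ-≡-pos r eq =
  QP.≤-antisym (QP.*-cancelʳ-≤-pos r (QP.≤-reflexive eq)) (QP.*-cancelʳ-≤-pos r (QP.≤-reflexive (sym eq)))

^ℚ-pos : ∀ {q} .{{_ : Positive q}} n → Positive (q ^ℚ n)
^ℚ-pos zero        = _
^ℚ-pos {q} (suc n) = QP.pos*pos⇒pos q (q ^ℚ n) {{^ℚ-pos n}}

ℕ→ℚ≡mkℚ : ∀ n → ℕ→ℚ n ≡ mkℚ (+ n) 0 (Coprimality.sym (Coprimality.1-coprimeTo n))
ℕ→ℚ≡mkℚ n = QP.normalize-coprime (Coprimality.sym (Coprimality.1-coprimeTo n))

ℕ→ℚ-injective : ∀ {m n} → ℕ→ℚ m ≡ ℕ→ℚ n → m ≡ n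
ℕ→ℚ-injective {m} {n} eq = ℤ.+-injective (cong ↥_ (trans (sym (ℕ→ℚ≡mkℚ m)) (trans eq (ℕ→ℚ≡mkℚ n))))

ℕ→ℚ-* : ∀ m n → ℕ→ℚ (m * n) ≡ ℕ→ℚ m Q.* ℕ→ℚ n
ℕ→ℚ-* m n rewrite ℕ→ℚ≡mkℚ m | ℕ→ℚ≡mkℚ n = cong (Q._/ 1) (ℤ.pos-* m n)

ℕ→ℚ-^ : ∀ m n → ℕ→ℚ (m ^ n) ≡ ℕ→ℚ m ^ℚ n
ℕ→ℚ-^ m zero    = refl
ℕ→ℚ-^ m (suc n) = trans (ℕ→ℚ-* m (m ^ n)) (cong (ℕ→ℚ m Q.*_) (ℕ→ℚ-^ m n))

ℕ→ℚ-square : ∀ n → ℕ→ℚ (n * n) ≡ ℕ→ℚ n ^ℚ 2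
ℕ→ℚ-square n = trans (cong (λ k → ℕ→ℚ (n * k)) (sym (ℕ.*-identityʳ n))) (ℕ→ℚ-^ n 2)

ℕ→ℚ-pos : ∀ n .{{_ : NonZero n}} → Positive (ℕ→ℚ n)
ℕ→ℚ-pos n = QP.normalize-pos n 1

∣↥∣-nonZero : ∀ q .{{_ : Positive q}} → NonZero ∣ ↥ q ∣
∣↥∣-nonZero (mkℚ +[1+ _ ] _ _) = _

*↧≡↥ : ∀ q .{{_ : Positive q}} → q Q.* ℕ→ℚ (↧ₙ q) ≡ ℕ→ℚ ∣ ↥ q ∣
*↧≡↥ q@(mkℚ +[1+ n ] d-1 _) = begin
  q Q.* ℕ→ℚ d ≡⟨ cong (q Q.*_) (ℕ→ℚ≡mkℚ d) ⟩
  Q.fromℚᵘ p ≡⟨ QP.fromℚᵘ-cong {p} {ℚᵘ.mkℚᵘ (+ suc n) 0} (ℚᵘ.*≡* cross) ⟩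
  Q.fromℚᵘ (ℚᵘ.mkℚᵘ (+ suc n) 0) ∎
  where
  open ≡-Reasoning
  d : ℕ
  d = suc d-1
  p : ℚᵘ.ℚᵘ
  p = ℚᵘ.mkℚᵘ (+ suc n ℤ.* + d) (d-1 * 1)
  cross : (+ suc n ℤ.* + d) ℤ.* + 1 ≡ + suc n ℤ.* + (d * 1)
  cross = trans (ℤ.*-identityʳ _) (cong (λ k → + suc n ℤ.* + k) (sym (ℕ.*-identityʳ d)))

^ℚ≡1⇒≡1 : ∀ {y} .{{_ : Positive y}} k .{{_ : NonZero k}} → y ^ℚ k ≡ 1ℚ → y ≡ 1ℚ
^ℚ≡1⇒≡1 {y} k yᵏ≡1 = *-cancelʳ-≡-pos (ℕ→ℚ d) {{ℕ→ℚ-pos d}} (begin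
  y Q.* ℕ→ℚ d   ≡⟨ *↧≡↥ y ⟩
  ℕ→ℚ r         ≡⟨ cong ℕ→ℚ r≡d ⟩
  ℕ→ℚ d         ≡⟨ QP.*-identityˡ (ℕ→ℚ d) ⟨
  1ℚ Q.* ℕ→ℚ d  ∎)
  where
  open ≡-Reasoning
  r d : ℕ
  r = ∣ ↥ y ∣
  d = ↧ₙ y
  r≡d : r ≡ d
  r≡d = ^-injectiveˡ k (ℕ→ℚ-injective (begin
    ℕ→ℚ (r ^ k)                   ≡⟨ ℕ→ℚ-^ r k ⟩
    ℕ→ℚ r ^ℚ k                    ≡⟨ cong (_^ℚ k) (*↧≡↥ y) ⟨
    (y Q.* ℕ→ℚ d) ^ℚ k            ≡⟨ ^-distrib-* y (ℕ→ℚ d) k ⟩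
    y ^ℚ k Q.* ℕ→ℚ d ^ℚ k         ≡⟨ cong (Q._* ℕ→ℚ d ^ℚ k) yᵏ≡1 ⟩
    1ℚ Q.* ℕ→ℚ d ^ℚ k             ≡⟨ QP.*-identityˡ (ℕ→ℚ d ^ℚ k) ⟩
    ℕ→ℚ d ^ℚ k                    ≡⟨ ℕ→ℚ-^ d k ⟨
    ℕ→ℚ (d ^ k)                   ∎))

^ℚ≡^ℚ⇒≡1 : ∀ {y} .{{_ : Positive y}} {i j} → i < j → y ^ℚ i ≡ y ^ℚ j → y ≡ 1ℚ
^ℚ≡^ℚ⇒≡1 {y} {i} {j} i<j yⁱ≡yʲ = ^ℚ≡1⇒≡1 k {{>-nonZero (ℕ.m<n⇒0<n∸m i<j)}}
  (*-cancelˡ-≡-pos (y ^ℚ i) {{^ℚ-pos i}} (begin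
    y ^ℚ i Q.* y ^ℚ k  ≡⟨ ^-homo-* y i k ⟨
    y ^ℚ (i + k)       ≡⟨ cong (y ^ℚ_) (ℕ.m+[n∸m]≡n (ℕ.<⇒≤ i<j)) ⟩
    y ^ℚ j             ≡⟨ yⁱ≡yʲ ⟨
    y ^ℚ i             ≡⟨ QP.*-identityʳ (y ^ℚ i) ⟨
    y ^ℚ i Q.* 1ℚ      ∎))
  where
  open ≡-Reasoning
  k : ℕ
  k = j ∸ i

^ℚ-injectiveʳ : ∀ {y} .{{_ : Positive y}} → y ≢ 1ℚ → ∀ {i j} → y ^ℚ i ≡ y ^ℚ j → i ≡ j
^ℚ-injectiveʳ y≢1 {i} {j} eq with ℕ.<-cmp i j
... | tri< i<j _ _ = ⊥-elim (y≢1 (^ℚ≡^ℚ⇒≡1 i<j eq))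
... | tri≈ _ i≡j _ = i≡j
... | tri> _ _ i>j = ⊥-elim (y≢1 (^ℚ≡^ℚ⇒≡1 i>j (sym eq)))

ℕ→ℚ-*-↥ : ∀ u p .{{_ : Positive p}} d →
          ℕ→ℚ (u * (∣ ↥ p ∣ * d)) ≡ (ℕ→ℚ u Q.* p) Q.* ℕ→ℚ (↧ₙ p * d)
ℕ→ℚ-*-↥ u p d = begin
  ℕ→ℚ (u * (∣ ↥ p ∣ * d))                      ≡⟨ ℕ→ℚ-* u (∣ ↥ p ∣ * d) ⟩
  ℕ→ℚ u Q.* ℕ→ℚ (∣ ↥ p ∣ * d)                  ≡⟨ cong (ℕ→ℚ u Q.*_) (ℕ→ℚ-* ∣ ↥ p ∣ d) ⟩
  ℕ→ℚ u Q.* (ℕ→ℚ ∣ ↥ p ∣ Q.* ℕ→ℚ d)            ≡⟨ cong (λ z → ℕ→ℚ u Q.* (z Q.* ℕ→ℚ d)) (*↧≡↥ p) ⟨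
  ℕ→ℚ u Q.* (p Q.* ℕ→ℚ (↧ₙ p) Q.* ℕ→ℚ d)       ≡⟨ cong (ℕ→ℚ u Q.*_) (QP.*-assoc p _ _) ⟩
  ℕ→ℚ u Q.* (p Q.* (ℕ→ℚ (↧ₙ p) Q.* ℕ→ℚ d))     ≡⟨ QP.*-assoc (ℕ→ℚ u) p _ ⟨
  (ℕ→ℚ u Q.* p) Q.* (ℕ→ℚ (↧ₙ p) Q.* ℕ→ℚ d)     ≡⟨ cong (ℕ→ℚ u Q.* p Q.*_) (ℕ→ℚ-* (↧ₙ p) d) ⟨
  (ℕ→ℚ u Q.* p) Q.* ℕ→ℚ (↧ₙ p * d)             ∎
  where open ≡-Reasoning

cross-multiplication⇒≡ : ∀ u v p q .{{_ : Positive p}} .{{_ : Positive q}} →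
                         u * (∣ ↥ p ∣ * ↧ₙ q) ≡ v * (∣ ↥ q ∣ * ↧ₙ p) → ℕ→ℚ u Q.* p ≡ ℕ→ℚ v Q.* q
cross-multiplication⇒≡ u v p q eq = *-cancelʳ-≡-pos (ℕ→ℚ (↧ₙ p * ↧ₙ q)) {{ℕ→ℚ-pos (↧ₙ p * ↧ₙ q)}} (begin
  (ℕ→ℚ u Q.* p) Q.* ℕ→ℚ (↧ₙ p * ↧ₙ q)  ≡⟨ ℕ→ℚ-*-↥ u p (↧ₙ q) ⟨
  ℕ→ℚ (u * (∣ ↥ p ∣ * ↧ₙ q))           ≡⟨ cong ℕ→ℚ eq ⟩
  ℕ→ℚ (v * (∣ ↥ q ∣ * ↧ₙ p))           ≡⟨ ℕ→ℚ-*-↥ v q (↧ₙ p) ⟩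
  (ℕ→ℚ v Q.* q) Q.* ℕ→ℚ (↧ₙ q * ↧ₙ p)  ≡⟨ cong (λ n → ℕ→ℚ v Q.* q Q.* ℕ→ℚ n) (ℕ.*-comm (↧ₙ q) (↧ₙ p)) ⟩
  (ℕ→ℚ v Q.* q) Q.* ℕ→ℚ (↧ₙ p * ↧ₙ q)  ∎)
  where open ≡-Reasoning

exponents-proportional : ∀ {x y w a b} .{{_ : Positive x}} .{{_ : Positive y}} .{{_ : Positive w}} →
                         y ≢ 1ℚ → RPowEq x y y w → pow y b ≡ pow x a → ℕ→ℚ b Q.* y ≡ ℕ→ℚ a Q.* w
exponents-proportional {x} {y} {w} {a} {b} y≢1 xʸ≡yʷ yᵇ≡xᵃ =
  cross-multiplication⇒≡ b a y w (^ℚ-injectiveʳ y≢1 (begin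
    y ^ℚ (b * N)   ≡⟨ ^-assocʳ y b N ⟨
    (y ^ℚ b) ^ℚ N  ≡⟨ cong (_^ℚ N) (pow≡pow⇒^ℚ≡^ℚ y b x a yᵇ≡xᵃ) ⟩
    (x ^ℚ a) ^ℚ N  ≡⟨ ^-assocʳ x a N ⟩
    x ^ℚ (a * N)   ≡⟨ cong (x ^ℚ_) (ℕ.*-comm a N) ⟩
    x ^ℚ (N * a)   ≡⟨ ^-assocʳ x N a ⟨
    (x ^ℚ N) ^ℚ a  ≡⟨ cong (_^ℚ a) (pow≡pow⇒^ℚ≡^ℚ x N y M xʸ≡yʷ) ⟩
    (y ^ℚ M) ^ℚ a  ≡⟨ ^-assocʳ y M a ⟩
    y ^ℚ (M * a)   ≡⟨ cong (y ^ℚ_) (ℕ.*-comm M a) ⟩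
    y ^ℚ (a * M)   ∎))
  where
  open ≡-Reasoning
  N M : ℕ
  N = ∣ ↥ y ∣ * ↧ₙ w
  M = ∣ ↥ w ∣ * ↧ₙ y

proportional⇒powers : ∀ {K L x y} c {d} → ℕ→ℚ K Q.* y ≡ ℕ→ℚ L Q.* x → y ^ℚ c ≡ x ^ℚ d →
                      ℕ→ℚ (K ^ c) Q.* x ^ℚ d ≡ ℕ→ℚ (L ^ c) Q.* x ^ℚ c
proportional⇒powers {K} {L} {x} {y} c Ky≡Lx yᶜ≡xᵈ = begin
  ℕ→ℚ (K ^ c) Q.* _        ≡⟨ cong₂ Q._*_ (ℕ→ℚ-^ K c) (sym yᶜ≡xᵈ) ⟩
  ℕ→ℚ K ^ℚ c Q.* y ^ℚ c    ≡⟨ ^-distrib-* (ℕ→ℚ K) y c ⟨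
  (ℕ→ℚ K Q.* y) ^ℚ c       ≡⟨ cong (_^ℚ c) Ky≡Lx ⟩
  (ℕ→ℚ L Q.* x) ^ℚ c       ≡⟨ ^-distrib-* (ℕ→ℚ L) x c ⟩
  ℕ→ℚ L ^ℚ c Q.* x ^ℚ c    ≡⟨ cong (Q._* x ^ℚ c) (ℕ→ℚ-^ L c) ⟨
  ℕ→ℚ (L ^ c) Q.* x ^ℚ c   ∎
  where open ≡-Reasoning

*-^-cancel : ∀ {p q x} .{{_ : Positive x}} i → p Q.* x ^ℚ (i + 2) ≡ q Q.* x ^ℚ i → p Q.* x ^ℚ 2 ≡ q
*-^-cancel {p} {q} {x} i eq = *-cancelʳ-≡-pos (x ^ℚ i) {{^ℚ-pos i}} (begin
  p Q.* x ^ℚ 2 Q.* x ^ℚ i    ≡⟨ QP.*-assoc p (x ^ℚ 2) (x ^ℚ i) ⟩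
  p Q.* (x ^ℚ 2 Q.* x ^ℚ i)  ≡⟨ cong (p Q.*_) (^-homo-* x 2 i) ⟨
  p Q.* x ^ℚ (2 + i)         ≡⟨ cong (λ n → p Q.* x ^ℚ n) (ℕ.+-comm 2 i) ⟩
  p Q.* x ^ℚ (i + 2)         ≡⟨ eq ⟩
  q Q.* x ^ℚ i               ∎)
  where open ≡-Reasoning

ℕ→ℚ-*-assoc : ∀ m n x → ℕ→ℚ m Q.* (ℕ→ℚ n Q.* x) ≡ ℕ→ℚ (m * n) Q.* x
ℕ→ℚ-*-assoc m n x = trans (sym (QP.*-assoc (ℕ→ℚ m) (ℕ→ℚ n) x)) (cong (Q._* x) (sym (ℕ→ℚ-* m n)))

clear-square-denominator : ∀ {A B x} .{{_ : Positive x}} →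
                           ℕ→ℚ A Q.* x ^ℚ 2 ≡ ℕ→ℚ B → A * (∣ ↥ x ∣ * ∣ ↥ x ∣) ≡ B * (↧ₙ x * ↧ₙ x)
clear-square-denominator {A} {B} {x} eq = ℕ→ℚ-injective (begin
  ℕ→ℚ (A * (r * r))                  ≡⟨ ℕ→ℚ-* A (r * r) ⟩
  ℕ→ℚ A Q.* ℕ→ℚ (r * r)              ≡⟨ cong (ℕ→ℚ A Q.*_) (ℕ→ℚ-square r) ⟩
  ℕ→ℚ A Q.* ℕ→ℚ r ^ℚ 2               ≡⟨ cong (λ z → ℕ→ℚ A Q.* z ^ℚ 2) (*↧≡↥ x) ⟨
  ℕ→ℚ A Q.* (x Q.* ℕ→ℚ s) ^ℚ 2       ≡⟨ cong (ℕ→ℚ A Q.*_) (^-distrib-* x (ℕ→ℚ s) 2) ⟩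
  ℕ→ℚ A Q.* (x ^ℚ 2 Q.* ℕ→ℚ s ^ℚ 2)  ≡⟨ QP.*-assoc (ℕ→ℚ A) (x ^ℚ 2) (ℕ→ℚ s ^ℚ 2) ⟨
  ℕ→ℚ A Q.* x ^ℚ 2 Q.* ℕ→ℚ s ^ℚ 2    ≡⟨ cong (Q._* ℕ→ℚ s ^ℚ 2) eq ⟩
  ℕ→ℚ B Q.* ℕ→ℚ s ^ℚ 2               ≡⟨ cong (ℕ→ℚ B Q.*_) (ℕ→ℚ-square s) ⟨
  ℕ→ℚ B Q.* ℕ→ℚ (s * s)              ≡⟨ ℕ→ℚ-* B (s * s) ⟨
  ℕ→ℚ (B * (s * s))                  ∎)
  where
  open ≡-Reasoning
  r s : ℕ
  r = ∣ ↥ x ∣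
  s = ↧ₙ x

twin-exponents⇒*-square : ∀ {K L x y a b} .{{_ : Positive x}} .{{_ : NonZero K}} .{{_ : NonZero L}} →
                          b % 2 ≡ 1 → a ≡ b + 2 ⊎ b ≡ a + 2 →
                          ℕ→ℚ K Q.* y ≡ ℕ→ℚ L Q.* x → y ^ℚ b ≡ x ^ℚ a → ∃[ c ] K * L ≡ c * c
twin-exponents⇒*-square {K} {L} {x} {y} {a} {b} b%2≡1 twin Ky≡Lx yᵇ≡xᵃ = square twin
  where
  Kᵇ Lᵇ : ℚ
  Kᵇ = ℕ→ℚ (K ^ b)
  Lᵇ = ℕ→ℚ (L ^ b)
  scaled : Kᵇ Q.* x ^ℚ a ≡ Lᵇ Q.* x ^ℚ b
  scaled = proportional⇒powers {K} {L} {x} {y} b {a} Ky≡Lx yᵇ≡xᵃ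
  balance : ∀ A B .{{_ : NonZero A}} → ℕ→ℚ (A ^ b) Q.* x ^ℚ 2 ≡ ℕ→ℚ (B ^ b) → ∃[ c ] A * B ≡ c * c
  balance A B eq = odd-power-balance⇒*-square {A} {B} {∣ ↥ x ∣} {↧ₙ x} b {{∣↥∣-nonZero x}} b%2≡1
    (clear-square-denominator {A ^ b} {B ^ b} {x} eq)
  square : a ≡ b + 2 ⊎ b ≡ a + 2 → ∃[ c ] K * L ≡ c * c
  square (inj₁ a≡b+2) = balance K L (*-^-cancel {Kᵇ} {Lᵇ} {x} b
    (subst (λ n → Kᵇ Q.* x ^ℚ n ≡ Lᵇ Q.* x ^ℚ b) a≡b+2 scaled))
  square (inj₂ b≡a+2) = map₂ (trans (ℕ.*-comm K L)) (balance L K (*-^-cancel {Lᵇ} {Kᵇ} {x} a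
    (sym (subst (λ n → Kᵇ Q.* x ^ℚ a ≡ Lᵇ Q.* x ^ℚ n) b≡a+2 scaled))))

lemma5 : (m e m₁ : ℕ) → 1 < m → m ≡ 2 ^ e * m₁ → m₁ % 2 ≡ 1 → m₁ % 4 ≡ 1 →
    ¬ (Σ ℚ λ x → Σ ℚ λ y → Σ ℕ λ a → Σ ℕ λ b →
         Positive x × Positive y × x ≢ 1ℚ × y ≢ 1ℚ
         × RPowEq x y y (ℕ→ℚ m Q.* x)
         × 0 < a × 0 < b × Coprime a b × (a ≡ b + 2 ⊎ b ≡ a + 2)
         × pow y b ≡ pow x a)
lemma5 m e m₁ 1<m m≡2ᵉm₁ _ m₁%4≡1
       (x , y , a , b , x>0 , y>0 , _ , y≢1 , xʸ≡yᵐˣ , a>0 , b>0 , a⊥b , twin , yᵇ≡xᵃ) =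
  twin-*-nonsquare e a⊥b twin m≡2ᵉm₁ m₁%4≡1
    (twin-exponents⇒*-square {b} {a * m} {x} {y} {a} {b} (twin-coprime⇒odd a⊥b twin) twin
      by≡amx (pow≡pow⇒^ℚ≡^ℚ y b x a yᵇ≡xᵃ))
  where
  instance
    x-pos : Positive x
    x-pos = x>0
    y-pos : Positive y
    y-pos = y>0
    m≢0 : NonZero m
    m≢0 = >-nonZero (ℕ.<⇒≤ 1<m)
    mx-pos : Positive (ℕ→ℚ m Q.* x)
    mx-pos = QP.pos*pos⇒pos (ℕ→ℚ m) {{ℕ→ℚ-pos m}} x
    b≢0 : NonZero b
    b≢0 = >-nonZero b>0
    am≢0 : NonZero (a * m)
    am≢0 = ℕ.m*n≢0 a m {{>-nonZero a>0}}
  by≡amx : ℕ→ℚ b Q.* y ≡ ℕ→ℚ (a * m) Q.* x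
  by≡amx = trans (exponents-proportional {x} {y} {ℕ→ℚ m Q.* x} {a} {b} y≢1 xʸ≡yᵐˣ yᵇ≡xᵃ) (ℕ→ℚ-*-assoc a m x)
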